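{- Let $M$ be a simple matroid of rank 3 that has a minor isomorphic to $U_{3,k}$ but no minor isomorphic to $U_{3,k+1}$. If $|E(M)|>\left(\binom{k-1}{2}-1\right)\binom{k}{2}+k$, then $M$ has a line $\ell$ (a rank-2 flat) such that $M\setminus\ell$ has no minor isomorphic to $U_{3,k-1}$.
   Context: $U_{r,m}$ is the uniform matroid of rank $r$ on $m$ elements; $M\setminus \ell$ denotes deletion of the set $\ell$. -}

module Defs where

open import Data.Nat using (ℕ; zero; suc; _+_; _∸_; _≤_; _<_; _⊓_)
open import Data.Bool using (Bool; true; false; if_then_else_)
open import Data.Fin using (Fin)
import Data.Fin as Fin
open import Data.Fin.Subset
  using (Subset; ⊥; ⊤; ⁅_⁆; _∈_; _∉_; _⊆_; _∪_; _∩_; _─_; ∁; ∣_∣; Empty)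
open import Data.Vec using ([]; _∷_)
open import Data.Product using (Σ; ∃; _×_; _,_)
open import Function using (_∘_)
open import Function.Definitions using (Injective)
open import Relation.Binary.PropositionalEquality using (_≡_; _≢_)
open import Relation.Nullary using (¬_)

record Matroid (n : ℕ) : Set where
  field
    rank        : Subset n → ℕ
    rank-≤-card : ∀ X → rank X ≤ ∣ X ∣
    rank-mono   : ∀ X Y → X ⊆ Y → rank X ≤ rank Y
    rank-submod : ∀ X Y → rank (X ∪ Y) + rank (X ∩ Y) ≤ rank X + rank Y
open Matroid public

image : ∀ {k n} → (Fin k → Fin n) → Subset k → Subset n
image {zero}  f []      = ⊥
image {suc k} f (b ∷ S) = (if b then ⁅ f Fin.zero ⁆ else ⊥) ∪ image (f ∘ Fin.suc) S

Disjoint : ∀ {n} → Subset n → Subset n → Set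
Disjoint C D = Empty (C ∩ D)

uniformRank : ∀ {m} → ℕ → Subset m → ℕ
uniformRank r S = ∣ S ∣ ⊓ r

-- A matroid with ground set a subset E of Fin n: the restriction M|E
-- (so M \ ℓ is the restriction of M to E ─ ℓ).
-- "M|E has a minor (M|E) / C \ D isomorphic to U_{r,m}": C, D disjoint
-- subsets of E, and a bijection f from Fin m onto E ─ (C ∪ D) such that the
-- minor's rank  X ↦ rank (X ∪ C) ∸ rank C  is transported to the rank of U_{r,m}.
HasUniformMinor : ∀ {n} → Matroid n → Subset n → (r m : ℕ) → Set
HasUniformMinor {n} M E r m =
  Σ (Subset n) λ C → Σ (Subset n) λ D →
    Disjoint C D × (C ∪ D) ⊆ E ×
    Σ (Fin m → Fin n) λ f →
      Injective _≡_ _≡_ f ×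
      image f ⊤ ≡ E ─ (C ∪ D) ×
      (∀ (S : Subset m) → rank M (image f S ∪ C) ∸ rank M C ≡ uniformRank r S)

Simple : ∀ {n} → Matroid n → Set
Simple M = (∀ e → rank M ⁅ e ⁆ ≡ 1)
         × (∀ e f → e ≢ f → rank M (⁅ e ⁆ ∪ ⁅ f ⁆) ≡ 2)

Flat : ∀ {n} → Matroid n → Subset n → Set
Flat M F = ∀ e → e ∉ F → rank M F < rank M (F ∪ ⁅ e ⁆)

Line : ∀ {n} → Matroid n → Subset n → Set
Line M ℓ = Flat M ℓ × rank M ℓ ≡ 2

{-# OPTIONS --safe #-}
module Submission where

-- In a simple rank-3 matroid a U_{3,m} minor is just an m-arc: m points no
-- three of which are collinear.  Fix a k-arc A.  As there is no (k+1)-arc,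
-- every point outside A lies on one of the C(k,2) lines through two points
-- of A, so by the bound on |E(M)| one of these lines, ℓ, carries more than
-- C(k-1,2)+1 points.  If M \ ℓ had a (k-1)-arc B, each of the C(k-1,2) lines
-- through two points of B would meet ℓ in at most one point, and at most one
-- further point of ℓ could avoid all of them, since two such points would
-- extend B to a (k+1)-arc.  Hence |ℓ| ≤ C(k-1,2)+1, a contradiction.

open import Defs
open import Data.Bool using (true; false)
open import Data.Empty using (⊥-elim)
open import Data.Fin using (Fin; zero; suc)
open import Data.Fin.Properties using (any?; suc-injective) renaming (_≟_ to _≟ᶠ_)
open import Data.Fin.Subset
open import Data.Fin.Subset.Properties
open import Data.List using (List; []; _∷_; _++_; length; map; filter; allFin)
open import Data.List.Membership.Propositional using () renaming (_∈_ to _∈ₗ_)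
open import Data.List.Membership.Propositional.Properties
  using (∈-++⁻; ∈-map⁺; ∈-filter⁺; ∈-filter⁻; ∈-allFin)
open import Data.List.Relation.Binary.Subset.Propositional using () renaming (_⊆_ to _⊆ₗ_)
open import Data.List.Relation.Unary.All using (All; []; _∷_)
import Data.List.Relation.Unary.All as All
open import Data.List.Relation.Unary.All.Properties using (all-filter)
open import Data.List.Relation.Unary.Any using (here; there)
open import Data.List.Relation.Unary.AllPairs using ([]; _∷_)
open import Data.List.Relation.Unary.Unique.Propositional using (Unique)
open import Data.Nat using (ℕ; zero; suc; _+_; _*_; _∸_; _≤_; _<_; _⊓_; z≤n; s≤s; _≤?_; _<?_)
open import Data.Nat.Combinatorics using (_C_; nCk+nC[k+1]≡[n+1]C[k+1]; nC1≡n)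
open import Data.Nat.Properties hiding (suc-injective)
open import Data.Product using (Σ; ∃₂; _×_; _,_; proj₁; proj₂)
open import Data.Sum using (inj₁; inj₂; [_,_]′)
open import Data.Vec using ([]; _∷_; here; there)
open import Data.Vec.Functional using () renaming (_∷_ to _∷ᶠ_)
open import Function using (_∘_)
open import Function.Definitions using (Injective)
open import Relation.Binary.PropositionalEquality
open import Relation.Nullary using (¬_; yes; no)
open import Relation.Nullary.Decidable using (¬?; _×-dec_; decidable-stable; map′)
open import Relation.Unary using (Decidable)

pattern ∈0 = here refl
pattern ∈1 = there ∈0
pattern ∈2 = there ∈1
pattern ∈3 = there ∈2
pattern ∈4 = there ∈3
pattern ∈5 = there ∈4
pattern ∈6 = there ∈5

All∈⇒⊆ : ∀ {A : Set} {xs ys : List A} → All (_∈ₗ ys) xs → xs ⊆ₗ ys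
All∈⇒⊆ = All.lookup

-- Finite subsets

∣p∪q∣≤∣p∣+∣q∣ : ∀ {n} (p q : Subset n) → ∣ p ∪ q ∣ ≤ ∣ p ∣ + ∣ q ∣
∣p∪q∣≤∣p∣+∣q∣ []          []          = z≤n
∣p∪q∣≤∣p∣+∣q∣ (true ∷ p)  (true ∷ q)  = s≤s (≤-trans (∣p∪q∣≤∣p∣+∣q∣ p q) (+-monoʳ-≤ ∣ p ∣ (n≤1+n _)))
∣p∪q∣≤∣p∣+∣q∣ (true ∷ p)  (false ∷ q) = s≤s (∣p∪q∣≤∣p∣+∣q∣ p q)
∣p∪q∣≤∣p∣+∣q∣ (false ∷ p) (true ∷ q)  = ≤-trans (s≤s (∣p∪q∣≤∣p∣+∣q∣ p q)) (≤-reflexive (sym (+-suc ∣ p ∣ ∣ q ∣)))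
∣p∪q∣≤∣p∣+∣q∣ (false ∷ p) (false ∷ q) = ∣p∪q∣≤∣p∣+∣q∣ p q

x∈p─q⁻ : ∀ {n} (p q : Subset n) {x} → x ∈ p ─ q → x ∈ p × x ∉ q
x∈p─q⁻ (true ∷ p)  (false ∷ q) {zero} here = here , λ ()
x∈p─q⁻ (false ∷ p) (false ∷ q) {zero} ()
x∈p─q⁻ (_ ∷ p)     (true ∷ q)  {zero} ()
x∈p─q⁻ (_ ∷ p)     (_ ∷ q)     {suc x} (there x∈p─q) with x∈p─q⁻ p q x∈p─q
... | x∈p , x∉q = there x∈p , λ { (there x∈q) → x∉q x∈q }

x∈p-y⁻ : ∀ {n} (p : Subset n) {x y} → x ∈ p - y → x ∈ p × x ≢ y
x∈p-y⁻ p {y = y} x∈p-y with x∈p─q⁻ p ⁅ y ⁆ x∈p-y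
... | x∈p , x∉⁅y⁆ = x∈p , x∉⁅y⁆⇒x≢y x∉⁅y⁆

x∈p⇒∣p∣≡1+∣p-x∣ : ∀ {n} (p : Subset n) {x} → x ∈ p → ∣ p ∣ ≡ suc ∣ p - x ∣
x∈p⇒∣p∣≡1+∣p-x∣ (true ∷ p)  here        = cong (suc ∘ ∣_∣) (sym (p─⊥≡p p))
x∈p⇒∣p∣≡1+∣p-x∣ (true ∷ p)  (there x∈p) = cong suc (x∈p⇒∣p∣≡1+∣p-x∣ p x∈p)
x∈p⇒∣p∣≡1+∣p-x∣ (false ∷ p) (there x∈p) = x∈p⇒∣p∣≡1+∣p-x∣ p x∈p

Empty⇒∣p∣≡0 : ∀ {n} {p : Subset n} → Empty p → ∣ p ∣ ≡ 0
Empty⇒∣p∣≡0 {n} p-empty rewrite Empty-unique p-empty = ∣⊥∣≡0 n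

x∉p⇒∣p∣<∣⁅x⁆∪p∣ : ∀ {n} {p : Subset n} {x} → x ∉ p → ∣ p ∣ < ∣ ⁅ x ⁆ ∪ p ∣
x∉p⇒∣p∣<∣⁅x⁆∪p∣ {p = p} {x} x∉p =
  p⊂q⇒∣p∣<∣q∣ (q⊆p∪q ⁅ x ⁆ p , x , x∈p∪q⁺ (inj₁ (x∈⁅x⁆ x)) , x∉p)

subsingleton⇒∣p∣≤1 : ∀ {n} (p : Subset n) → (∀ {x y} → x ∈ p → y ∈ p → x ≡ y) → ∣ p ∣ ≤ 1
subsingleton⇒∣p∣≤1 p unique with nonempty? p
... | no p-empty = ≤-trans (≤-reflexive (Empty⇒∣p∣≡0 p-empty)) z≤n
... | yes (x , x∈p) =
  ≤-reflexive (trans (x∈p⇒∣p∣≡1+∣p-x∣ p x∈p) (cong suc (Empty⇒∣p∣≡0 p-x-empty)))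
  where
  p-x-empty : Empty (p - x)
  p-x-empty (y , y∈p-x) with x∈p-y⁻ p y∈p-x
  ... | y∈p , y≢x = y≢x (unique y∈p x∈p)

⊤─[⊥∪∁p]≡p : ∀ {n} (p : Subset n) → ⊤ ─ (⊥ ∪ ∁ p) ≡ p
⊤─[⊥∪∁p]≡p []          = refl
⊤─[⊥∪∁p]≡p (true ∷ p)  = cong (true ∷_) (⊤─[⊥∪∁p]≡p p)
⊤─[⊥∪∁p]≡p (false ∷ p) = cong (false ∷_) (⊤─[⊥∪∁p]≡p p)

∈-image⁺ : ∀ {k n} (f : Fin k → Fin n) (S : Subset k) {s} → s ∈ S → f s ∈ image f S
∈-image⁺ f (true ∷ S) here        = x∈p∪q⁺ (inj₁ (x∈⁅x⁆ (f zero)))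
∈-image⁺ f (_ ∷ S)    (there s∈S) = x∈p∪q⁺ (inj₂ (∈-image⁺ (f ∘ suc) S s∈S))

∈-image⁻ : ∀ {k n} (f : Fin k → Fin n) (S : Subset k) {y} →
           y ∈ image f S → Σ (Fin k) λ s → s ∈ S × y ≡ f s
∈-image⁻ f [] y∈ = ⊥-elim (∉⊥ y∈)
∈-image⁻ f (true ∷ S) y∈ with x∈p∪q⁻ ⁅ f zero ⁆ (image (f ∘ suc) S) y∈
... | inj₁ y∈⁅f0⁆ = zero , here , x∈⁅y⁆⇒x≡y (f zero) y∈⁅f0⁆
... | inj₂ y∈rest with ∈-image⁻ (f ∘ suc) S y∈rest
...   | s , s∈S , y≡fs = suc s , there s∈S , y≡fs
∈-image⁻ f (false ∷ S) y∈ with x∈p∪q⁻ ⊥ (image (f ∘ suc) S) y∈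
... | inj₁ y∈⊥ = ⊥-elim (∉⊥ y∈⊥)
... | inj₂ y∈rest with ∈-image⁻ (f ∘ suc) S y∈rest
...   | s , s∈S , y≡fs = suc s , there s∈S , y≡fs

∣image∣≤ : ∀ {k n} (f : Fin k → Fin n) (S : Subset k) → ∣ image f S ∣ ≤ ∣ S ∣
∣image∣≤ {n = n} f [] = ≤-reflexive (∣⊥∣≡0 n)
∣image∣≤ f (true ∷ S) = begin
  ∣ ⁅ f zero ⁆ ∪ image (f ∘ suc) S ∣       ≤⟨ ∣p∪q∣≤∣p∣+∣q∣ ⁅ f zero ⁆ (image (f ∘ suc) S) ⟩
  ∣ ⁅ f zero ⁆ ∣ + ∣ image (f ∘ suc) S ∣   ≡⟨ cong (_+ ∣ image (f ∘ suc) S ∣) (∣⁅x⁆∣≡1 (f zero)) ⟩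
  suc ∣ image (f ∘ suc) S ∣               ≤⟨ s≤s (∣image∣≤ (f ∘ suc) S) ⟩
  suc ∣ S ∣                               ∎
  where open ≤-Reasoning
∣image∣≤ {n = n} f (false ∷ S) = begin
  ∣ ⊥ ∪ image (f ∘ suc) S ∣                ≤⟨ ∣p∪q∣≤∣p∣+∣q∣ ⊥ (image (f ∘ suc) S) ⟩
  ∣ ⊥ {n} ∣ + ∣ image (f ∘ suc) S ∣        ≡⟨ cong (_+ ∣ image (f ∘ suc) S ∣) (∣⊥∣≡0 n) ⟩
  ∣ image (f ∘ suc) S ∣                   ≤⟨ ∣image∣≤ (f ∘ suc) S ⟩
  ∣ S ∣                                   ∎
  where open ≤-Reasoning

fromList : ∀ {n} → List (Fin n) → Subset n
fromList []       = ⊥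
fromList (x ∷ xs) = ⁅ x ⁆ ∪ fromList xs

module _ {n : ℕ} where

  ∈-fromList⁺ : ∀ {x : Fin n} {xs} → x ∈ₗ xs → x ∈ fromList xs
  ∈-fromList⁺ {x} (here refl)  = x∈p∪q⁺ (inj₁ (x∈⁅x⁆ x))
  ∈-fromList⁺     (there x∈xs) = x∈p∪q⁺ (inj₂ (∈-fromList⁺ x∈xs))

  ∈-fromList⁻ : ∀ {x : Fin n} xs → x ∈ fromList xs → x ∈ₗ xs
  ∈-fromList⁻ []       x∈ = ⊥-elim (∉⊥ x∈)
  ∈-fromList⁻ (y ∷ xs) x∈ =
    [ here ∘ x∈⁅y⁆⇒x≡y y , there ∘ ∈-fromList⁻ xs ]′ (x∈p∪q⁻ ⁅ y ⁆ (fromList xs) x∈)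

  fromList-mono : ∀ {xs ys : List (Fin n)} → xs ⊆ₗ ys → fromList xs ⊆ fromList ys
  fromList-mono {xs} xs⊆ys = ∈-fromList⁺ ∘ xs⊆ys ∘ ∈-fromList⁻ xs

  fromList⊆ : ∀ {p : Subset n} xs → All (_∈ p) xs → fromList xs ⊆ p
  fromList⊆ xs xs⊆p = All.lookup xs⊆p ∘ ∈-fromList⁻ xs

  fromList-++ : ∀ xs {ys : List (Fin n)} → fromList (xs ++ ys) ⊆ fromList xs ∪ fromList ys
  fromList-++ xs {ys} x∈ with ∈-++⁻ xs (∈-fromList⁻ (xs ++ ys) x∈)
  ... | inj₁ x∈xs = x∈p∪q⁺ (inj₁ (∈-fromList⁺ x∈xs))
  ... | inj₂ x∈ys = x∈p∪q⁺ (inj₂ (∈-fromList⁺ x∈ys))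

  ∣fromList∣≤length : (xs : List (Fin n)) → ∣ fromList xs ∣ ≤ length xs
  ∣fromList∣≤length []       = ≤-reflexive (∣⊥∣≡0 n)
  ∣fromList∣≤length (x ∷ xs) = begin
    ∣ ⁅ x ⁆ ∪ fromList xs ∣        ≤⟨ ∣p∪q∣≤∣p∣+∣q∣ ⁅ x ⁆ (fromList xs) ⟩
    ∣ ⁅ x ⁆ ∣ + ∣ fromList xs ∣    ≡⟨ cong (_+ ∣ fromList xs ∣) (∣⁅x⁆∣≡1 x) ⟩
    suc ∣ fromList xs ∣           ≤⟨ s≤s (∣fromList∣≤length xs) ⟩
    suc (length xs)               ∎
    where open ≤-Reasoning

  length≤∣fromList∣ : ∀ {xs : List (Fin n)} → Unique xs → length xs ≤ ∣ fromList xs ∣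
  length≤∣fromList∣ []                       = z≤n
  length≤∣fromList∣ {x ∷ xs} (x∉xs ∷ unique) =
    ≤-trans (s≤s (length≤∣fromList∣ unique))
            (x∉p⇒∣p∣<∣⁅x⁆∪p∣ (λ x∈ → All.lookup x∉xs (∈-fromList⁻ xs x∈) refl))

  satisfying : ∀ {P : Fin n → Set} → Decidable P → Subset n
  satisfying P? = fromList (filter P? (allFin n))

  ∈-satisfying⁺ : ∀ {P : Fin n → Set} (P? : Decidable P) {x} → P x → x ∈ satisfying P?
  ∈-satisfying⁺ P? {x} Px = ∈-fromList⁺ (∈-filter⁺ P? (∈-allFin x) Px)

  ∈-satisfying⁻ : ∀ {P : Fin n → Set} (P? : Decidable P) {x} → x ∈ satisfying P? → P x
  ∈-satisfying⁻ P? x∈ = proj₂ (∈-filter⁻ P? {xs = allFin n} (∈-fromList⁻ (filter P? (allFin n)) x∈))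

image-fromList : ∀ {k n} (f : Fin k → Fin n) (xs : List (Fin k)) → image f (fromList xs) ⊆ fromList (map f xs)
image-fromList f xs y∈ with ∈-image⁻ f (fromList xs) y∈
... | s , s∈ , refl = ∈-fromList⁺ (∈-map⁺ f (∈-fromList⁻ xs s∈))

-- Unions indexed by Fin m and by pairs of elements of Fin m

[1+m]C2≡m+mC2 : ∀ m → suc m C 2 ≡ m + m C 2
[1+m]C2≡m+mC2 m = trans (sym (nCk+nC[k+1]≡[n+1]C[k+1] m 1)) (cong (_+ m C 2) (nC1≡n m))

module _ {n : ℕ} where

  ⋃ᶠ : (m : ℕ) → (Fin m → Subset n) → Subset n
  ⋃ᶠ zero    F = ⊥
  ⋃ᶠ (suc m) F = F zero ∪ ⋃ᶠ m (F ∘ suc)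

  ∈-⋃ᶠ : ∀ m F (i : Fin m) {x} → x ∈ F i → x ∈ ⋃ᶠ m F
  ∈-⋃ᶠ (suc m) F zero    x∈ = x∈p∪q⁺ (inj₁ x∈)
  ∈-⋃ᶠ (suc m) F (suc i) x∈ = x∈p∪q⁺ (inj₂ (∈-⋃ᶠ m (F ∘ suc) i x∈))

  ∣⋃ᶠ∣≤ : ∀ m F b → (∀ i → ∣ F i ∣ ≤ b) → ∣ ⋃ᶠ m F ∣ ≤ m * b
  ∣⋃ᶠ∣≤ zero    F b F≤b = ≤-reflexive (∣⊥∣≡0 n)
  ∣⋃ᶠ∣≤ (suc m) F b F≤b = ≤-trans (∣p∪q∣≤∣p∣+∣q∣ (F zero) (⋃ᶠ m (F ∘ suc)))
                                  (+-mono-≤ (F≤b zero) (∣⋃ᶠ∣≤ m (F ∘ suc) b (F≤b ∘ suc)))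

  -- ⋃ᵖ m G is the union of the sets G i j over all pairs i < j.
  ⋃ᵖ : (m : ℕ) → (Fin m → Fin m → Subset n) → Subset n
  ⋃ᵖ zero    G = ⊥
  ⋃ᵖ (suc m) G = ⋃ᶠ m (G zero ∘ suc) ∪ ⋃ᵖ m (λ i j → G (suc i) (suc j))

  ∈-⋃ᵖ : ∀ m G {i j : Fin m} {x} → i ≢ j → x ∈ G i j → x ∈ G j i → x ∈ ⋃ᵖ m G
  ∈-⋃ᵖ (suc m) G {zero}  {zero}  i≢j _ _ = ⊥-elim (i≢j refl)
  ∈-⋃ᵖ (suc m) G {zero}  {suc j} _ x∈ _ = x∈p∪q⁺ (inj₁ (∈-⋃ᶠ m (G zero ∘ suc) j x∈))
  ∈-⋃ᵖ (suc m) G {suc i} {zero}  _ _ x∈ = x∈p∪q⁺ (inj₁ (∈-⋃ᶠ m (G zero ∘ suc) i x∈))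
  ∈-⋃ᵖ (suc m) G {suc i} {suc j} i≢j x∈ x∈′ =
    x∈p∪q⁺ (inj₂ (∈-⋃ᵖ m (λ i j → G (suc i) (suc j)) (i≢j ∘ cong suc) x∈ x∈′))

  ∣⋃ᵖ∣≤ : ∀ m G b → (∀ i j → i ≢ j → ∣ G i j ∣ ≤ b) → ∣ ⋃ᵖ m G ∣ ≤ (m C 2) * b
  ∣⋃ᵖ∣≤ zero    G b G≤b = ≤-reflexive (∣⊥∣≡0 n)
  ∣⋃ᵖ∣≤ (suc m) G b G≤b = begin
    ∣ ⋃ᶠ m (G zero ∘ suc) ∪ ⋃ᵖ m G′ ∣          ≤⟨ ∣p∪q∣≤∣p∣+∣q∣ (⋃ᶠ m (G zero ∘ suc)) (⋃ᵖ m G′) ⟩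
    ∣ ⋃ᶠ m (G zero ∘ suc) ∣ + ∣ ⋃ᵖ m G′ ∣      ≤⟨ +-mono-≤ (∣⋃ᶠ∣≤ m (G zero ∘ suc) b (λ j → G≤b zero (suc j) λ ()))
                                                          (∣⋃ᵖ∣≤ m G′ b λ i j i≢j → G≤b (suc i) (suc j) (i≢j ∘ suc-injective)) ⟩
    m * b + (m C 2) * b                        ≡⟨ sym (*-distribʳ-+ b m (m C 2)) ⟩
    (m + m C 2) * b                            ≡⟨ cong (_* b) (sym ([1+m]C2≡m+mC2 m)) ⟩
    (suc m C 2) * b                            ∎
    where
    open ≤-Reasoning
    G′ : Fin m → Fin m → Subset n
    G′ i j = G (suc i) (suc j)

-- Collinearity, lines and arcs in a matroid

module Geometry {n : ℕ} (M : Matroid n) where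

  rk : Subset n → ℕ
  rk = rank M

  rk-mono : ∀ {X Y} → X ⊆ Y → rk X ≤ rk Y
  rk-mono {X} {Y} = rank-mono M X Y

  rk⊥≡0 : rk ⊥ ≡ 0
  rk⊥≡0 = n≤0⇒n≡0 (≤-trans (rank-≤-card M ⊥) (≤-reflexive (∣⊥∣≡0 n)))

  rk-∪≤+ : ∀ X Y → rk (X ∪ Y) ≤ rk X + rk Y
  rk-∪≤+ X Y = ≤-trans (m≤m+n (rk (X ∪ Y)) (rk (X ∩ Y))) (rank-submod M X Y)

  rk-∪≤ : ∀ {r} X Y → rk X ≤ r → rk Y ≤ r → r ≤ rk (X ∩ Y) → rk (X ∪ Y) ≤ r
  rk-∪≤ {r} X Y X≤r Y≤r r≤X∩Y = +-cancelʳ-≤ r (rk (X ∪ Y)) r (begin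
    rk (X ∪ Y) + r           ≤⟨ +-monoʳ-≤ (rk (X ∪ Y)) r≤X∩Y ⟩
    rk (X ∪ Y) + rk (X ∩ Y)  ≤⟨ rank-submod M X Y ⟩
    rk X + rk Y              ≤⟨ +-mono-≤ X≤r Y≤r ⟩
    r + r                    ∎)
    where open ≤-Reasoning

  -- A record rather than a synonym, so that the list is inferable from the type.
  record Collinear (xs : List (Fin n)) : Set where
    constructor collinear
    field rk≤2 : rk (fromList xs) ≤ 2

  Col : Fin n → Fin n → Fin n → Set
  Col a b e = Collinear (a ∷ b ∷ e ∷ [])

  col? : ∀ a b → Decidable (Col a b)
  col? a b e = map′ collinear Collinear.rk≤2 (rk (fromList (a ∷ b ∷ e ∷ [])) ≤? 2)

  Collinear-⊆ : ∀ {xs ys} → xs ⊆ₗ ys → Collinear ys → Collinear xs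
  Collinear-⊆ xs⊆ys (collinear ys≤2) = collinear (≤-trans (rk-mono (fromList-mono xs⊆ys)) ys≤2)

  Collinear-pair : ∀ a b → Collinear (a ∷ b ∷ [])
  Collinear-pair a b = collinear (≤-trans (rank-≤-card M _) (∣fromList∣≤length (a ∷ b ∷ [])))

  Collinear-++ : ∀ xs ys {zs} → Collinear xs → Collinear ys → 2 ≤ rk (fromList zs) →
                 zs ⊆ₗ xs → zs ⊆ₗ ys → Collinear (xs ++ ys)
  Collinear-++ xs ys {zs} (collinear xs≤2) (collinear ys≤2) 2≤zs zs⊆xs zs⊆ys = collinear
    (≤-trans (rk-mono (fromList-++ xs))
             (rk-∪≤ (fromList xs) (fromList ys) xs≤2 ys≤2 (≤-trans 2≤zs (rk-mono zs⊆both))))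
    where
    zs⊆both : fromList zs ⊆ fromList xs ∩ fromList ys
    zs⊆both x∈ = x∈p∩q⁺ (fromList-mono zs⊆xs x∈ , fromList-mono zs⊆ys x∈)

  Col-swap : ∀ {a b e} → Col a b e → Col b a e
  Col-swap = Collinear-⊆ (All∈⇒⊆ (∈1 ∷ ∈0 ∷ ∈2 ∷ []))

  line : Fin n → Fin n → Subset n
  line a b = satisfying (col? a b)

  a∈line : ∀ a b → a ∈ line a b
  a∈line a b = ∈-satisfying⁺ (col? a b) (Collinear-⊆ (All∈⇒⊆ (∈0 ∷ ∈1 ∷ ∈0 ∷ [])) (Collinear-pair a b))

  b∈line : ∀ a b → b ∈ line a b
  b∈line a b = ∈-satisfying⁺ (col? a b) (Collinear-⊆ (All∈⇒⊆ (∈0 ∷ ∈1 ∷ ∈1 ∷ [])) (Collinear-pair a b))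

  Arc : (m : ℕ) → (Fin m → Fin n) → Set
  Arc m g = Injective _≡_ _≡_ g × (∀ i j l → i ≢ j → i ≢ l → j ≢ l → ¬ Col (g i) (g j) (g l))

  Arc-extend : ∀ {m} {g : Fin m → Fin n} {e} → Arc m g → (∀ u → e ≢ g u) →
               (∀ u v → u ≢ v → ¬ Col (g u) (g v) e) → Arc (suc m) (e ∷ᶠ g)
  Arc-extend {g = g} {e} (g-inj , g-general) e∉g e-off = inj , general
    where
    inj : Injective _≡_ _≡_ (e ∷ᶠ g)
    inj {zero}  {zero}  _  = refl
    inj {zero}  {suc j} eq = ⊥-elim (e∉g j eq)
    inj {suc i} {zero}  eq = ⊥-elim (e∉g i (sym eq))
    inj {suc i} {suc j} eq = cong suc (g-inj eq)
    general : ∀ i j l → i ≢ j → i ≢ l → j ≢ l → ¬ Col ((e ∷ᶠ g) i) ((e ∷ᶠ g) j) ((e ∷ᶠ g) l)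
    general zero    zero    _       i≢j _   _   = ⊥-elim (i≢j refl)
    general zero    (suc j) zero    _   i≢l _   = ⊥-elim (i≢l refl)
    general zero    (suc j) (suc l) _   _   j≢l =
      e-off j l (j≢l ∘ cong suc) ∘ Collinear-⊆ (All∈⇒⊆ (∈1 ∷ ∈2 ∷ ∈0 ∷ []))
    general (suc i) zero    zero    _   _   j≢l = ⊥-elim (j≢l refl)
    general (suc i) zero    (suc l) _   i≢l _   =
      e-off i l (i≢l ∘ cong suc) ∘ Collinear-⊆ (All∈⇒⊆ (∈0 ∷ ∈2 ∷ ∈1 ∷ []))
    general (suc i) (suc j) zero    i≢j _   _   = e-off i j (i≢j ∘ cong suc)
    general (suc i) (suc j) (suc l) i≢j i≢l j≢l =
      g-general i j l (i≢j ∘ cong suc) (i≢l ∘ cong suc) (j≢l ∘ cong suc)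

  minor⇒arc : ∀ {E m} → HasUniformMinor M E 3 m →
              Σ (Fin m → Fin n) λ g → Arc m g × (∀ i → g i ∈ E)
  minor⇒arc {E} (C , D , _ , _ , f , f-inj , f[⊤]≡E─C∪D , f-rank) = f , (f-inj , general) , f∈E
    where
    f∈E : ∀ i → f i ∈ E
    f∈E i = p─q⊆p E (C ∪ D) (subst (f i ∈_) f[⊤]≡E─C∪D (∈-image⁺ f ⊤ ∈⊤))
    3≤rk-image : ∀ S → 3 ≤ ∣ S ∣ → 3 ≤ rk (image f S)
    3≤rk-image S 3≤∣S∣ = begin
      3                               ≡⟨ sym (m≥n⇒m⊓n≡n 3≤∣S∣) ⟩
      ∣ S ∣ ⊓ 3                       ≡⟨ sym (f-rank S) ⟩
      rk (image f S ∪ C) ∸ rk C       ≤⟨ ∸-monoˡ-≤ (rk C) (rk-∪≤+ (image f S) C) ⟩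
      rk (image f S) + rk C ∸ rk C    ≡⟨ m+n∸n≡m (rk (image f S)) (rk C) ⟩
      rk (image f S)                  ∎
      where open ≤-Reasoning
    general : ∀ i j l → i ≢ j → i ≢ l → j ≢ l → ¬ Col (f i) (f j) (f l)
    general i j l i≢j i≢l j≢l ijl-col =
      <⇒≱ (3≤rk-image (fromList (i ∷ j ∷ l ∷ [])) (length≤∣fromList∣ distinct))
          (≤-trans (rk-mono (image-fromList f (i ∷ j ∷ l ∷ []))) (Collinear.rk≤2 ijl-col))
      where
      distinct : Unique (i ∷ j ∷ l ∷ [])
      distinct = (i≢j ∷ i≢l ∷ []) ∷ (j≢l ∷ []) ∷ [] ∷ []

  module _ (simple : Simple M) where

    rk-point : ∀ e → 1 ≤ rk (fromList (e ∷ []))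
    rk-point e = ≤-trans (≤-reflexive (sym (proj₁ simple e))) (rk-mono (p⊆p∪q ⊥))

    rk-pair : ∀ {e f} → e ≢ f → 2 ≤ rk (fromList (e ∷ f ∷ []))
    rk-pair {e} {f} e≢f = ≤-trans (≤-reflexive (sym (proj₂ simple e f e≢f))) (rk-mono ⁅e⁆∪⁅f⁆⊆)
      where
      ⁅e⁆∪⁅f⁆⊆ : ⁅ e ⁆ ∪ ⁅ f ⁆ ⊆ fromList (e ∷ f ∷ [])
      ⁅e⁆∪⁅f⁆⊆ x∈ = [ (λ x∈⁅e⁆ → ∈-fromList⁺ {xs = e ∷ f ∷ []} (here (x∈⁅y⁆⇒x≡y e x∈⁅e⁆)))
                    , (λ x∈⁅f⁆ → ∈-fromList⁺ {xs = e ∷ f ∷ []} (there (here (x∈⁅y⁆⇒x≡y f x∈⁅f⁆)))) ]′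
                    (x∈p∪q⁻ ⁅ e ⁆ ⁅ f ⁆ x∈)

    Col₂⇒Collinear : ∀ {a b x y} → a ≢ b → Col a b x → Col a b y → Collinear (a ∷ b ∷ x ∷ y ∷ [])
    Col₂⇒Collinear {a} {b} {x} {y} a≢b abx aby =
      Collinear-⊆ (All∈⇒⊆ (∈0 ∷ ∈1 ∷ ∈2 ∷ ∈5 ∷ []))
        (Collinear-++ (a ∷ b ∷ x ∷ []) (a ∷ b ∷ y ∷ []) abx aby (rk-pair a≢b)
                      (All∈⇒⊆ (∈0 ∷ ∈1 ∷ [])) (All∈⇒⊆ (∈0 ∷ ∈1 ∷ [])))

    Col-rebase : ∀ {a b x y e} → x ≢ y → Collinear (a ∷ b ∷ x ∷ y ∷ []) → Col x y e → Col a b e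
    Col-rebase {a} {b} {x} {y} {e} x≢y abxy xye =
      Collinear-⊆ (All∈⇒⊆ (∈0 ∷ ∈1 ∷ ∈6 ∷ []))
        (Collinear-++ (a ∷ b ∷ x ∷ y ∷ []) (x ∷ y ∷ e ∷ []) abxy xye (rk-pair x≢y)
                      (All∈⇒⊆ (∈2 ∷ ∈3 ∷ [])) (All∈⇒⊆ (∈0 ∷ ∈1 ∷ [])))

    Col⇒∈-line : ∀ {a b x y e} → a ≢ b → x ≢ y → x ∈ line a b → y ∈ line a b → Col x y e → e ∈ line a b
    Col⇒∈-line {a} {b} a≢b x≢y x∈ y∈ xye = ∈-satisfying⁺ (col? a b)
      (Col-rebase x≢y (Col₂⇒Collinear a≢b (∈-satisfying⁻ (col? a b) x∈) (∈-satisfying⁻ (col? a b) y∈)) xye)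

    ∣line∩line∣≤1 : ∀ {a b c d} → a ≢ b → c ≢ d → c ∉ line a b → ∣ line a b ∩ line c d ∣ ≤ 1
    ∣line∩line∣≤1 {a} {b} {c} {d} a≢b c≢d c∉ab = subsingleton⇒∣p∣≤1 (line a b ∩ line c d) meet-once
      where
      meet-once : ∀ {x y} → x ∈ line a b ∩ line c d → y ∈ line a b ∩ line c d → x ≡ y
      meet-once {x} {y} x∈ y∈ with x∈p∩q⁻ (line a b) (line c d) x∈ | x∈p∩q⁻ (line a b) (line c d) y∈
      ... | x∈ab , x∈cd | y∈ab , y∈cd = decidable-stable (x ≟ᶠ y) λ x≢y →
        c∉ab (Col⇒∈-line a≢b x≢y x∈ab y∈ab (Collinear-⊆ (All∈⇒⊆ (∈2 ∷ ∈3 ∷ ∈0 ∷ []))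
          (Col₂⇒Collinear c≢d (∈-satisfying⁻ (col? c d) x∈cd) (∈-satisfying⁻ (col? c d) y∈cd))))

    Collinear-spanned : ∀ {a b} → a ≢ b → ∀ xs → All (Col a b) xs → Collinear (a ∷ b ∷ xs)
    Collinear-spanned {a} {b} a≢b []       []            = Collinear-pair a b
    Collinear-spanned {a} {b} a≢b (x ∷ xs) (abx ∷ ab-xs) =
      Collinear-⊆ reorder
        (Collinear-++ (a ∷ b ∷ x ∷ []) (a ∷ b ∷ xs) abx (Collinear-spanned a≢b xs ab-xs) (rk-pair a≢b)
                      (All∈⇒⊆ (∈0 ∷ ∈1 ∷ [])) (All∈⇒⊆ (∈0 ∷ ∈1 ∷ [])))
      where
      reorder : a ∷ b ∷ x ∷ xs ⊆ₗ a ∷ b ∷ x ∷ a ∷ b ∷ xs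
      reorder (here w≡a)                   = here w≡a
      reorder (there (here w≡b))           = there (here w≡b)
      reorder (there (there (here w≡x)))   = there (there (here w≡x))
      reorder (there (there (there w∈xs))) = there (there (there (there (there w∈xs))))

    line-Line : ∀ {a b} → a ≢ b → Line M (line a b)
    line-Line {a} {b} a≢b = flat , rk-line≡2
      where
      rk-line≡2 : rk (line a b) ≡ 2
      rk-line≡2 = ≤-antisym
        (Collinear.rk≤2 (Collinear-⊆ (λ w∈ → there (there w∈)) (Collinear-spanned a≢b _ (all-filter (col? a b) (allFin n)))))
        (≤-trans (rk-pair a≢b) (rk-mono (fromList⊆ (a ∷ b ∷ []) (a∈line a b ∷ b∈line a b ∷ []))))
      flat : Flat M (line a b)
      flat e e∉ with rk (line a b ∪ ⁅ e ⁆) ≤? 2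
      ... | yes ≤2 = ⊥-elim (e∉ (∈-satisfying⁺ (col? a b) (collinear (≤-trans (rk-mono abe⊆) ≤2))))
        where
        abe⊆ : fromList (a ∷ b ∷ e ∷ []) ⊆ line a b ∪ ⁅ e ⁆
        abe⊆ = fromList⊆ (a ∷ b ∷ e ∷ [])
          (x∈p∪q⁺ (inj₁ (a∈line a b)) ∷ x∈p∪q⁺ (inj₁ (b∈line a b)) ∷ x∈p∪q⁺ (inj₂ (x∈⁅x⁆ e)) ∷ [])
      ... | no ≰2 = subst (_< rk (line a b ∪ ⁅ e ⁆)) (sym rk-line≡2) (≰⇒> ≰2)

    ⊓3≤rk-image : ∀ {m} {g : Fin m → Fin n} → Arc m g → ∀ S → ∣ S ∣ ⊓ 3 ≤ rk (image g S)
    ⊓3≤rk-image {g = g} (g-inj , g-general) S with nonempty? S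
    ... | no S-empty = ≤-trans (m⊓n≤m ∣ S ∣ 3) (≤-trans (≤-reflexive (Empty⇒∣p∣≡0 S-empty)) z≤n)
    ... | yes (x , x∈S) with nonempty? (S - x)
    ...   | no S-x-empty = begin
      ∣ S ∣ ⊓ 3                    ≤⟨ m⊓n≤m ∣ S ∣ 3 ⟩
      ∣ S ∣                        ≡⟨ x∈p⇒∣p∣≡1+∣p-x∣ S x∈S ⟩
      suc ∣ S - x ∣                ≡⟨ cong suc (Empty⇒∣p∣≡0 S-x-empty) ⟩
      1                            ≤⟨ rk-point (g x) ⟩
      rk (fromList (g x ∷ []))     ≤⟨ rk-mono (fromList⊆ (g x ∷ []) (∈-image⁺ g S x∈S ∷ [])) ⟩
      rk (image g S)               ∎
      where open ≤-Reasoning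
    ...   | yes (y , y∈S-x) with x∈p-y⁻ S y∈S-x | nonempty? (S - x - y)
    ...     | y∈S , y≢x | no S-x-y-empty = begin
      ∣ S ∣ ⊓ 3                         ≤⟨ m⊓n≤m ∣ S ∣ 3 ⟩
      ∣ S ∣                             ≡⟨ x∈p⇒∣p∣≡1+∣p-x∣ S x∈S ⟩
      suc ∣ S - x ∣                     ≡⟨ cong suc (x∈p⇒∣p∣≡1+∣p-x∣ (S - x) y∈S-x) ⟩
      suc (suc ∣ S - x - y ∣)           ≡⟨ cong (λ c → suc (suc c)) (Empty⇒∣p∣≡0 S-x-y-empty) ⟩
      2                                 ≤⟨ rk-pair (y≢x ∘ sym ∘ g-inj) ⟩
      rk (fromList (g x ∷ g y ∷ []))    ≤⟨ rk-mono (fromList⊆ (g x ∷ g y ∷ []) (∈-image⁺ g S x∈S ∷ ∈-image⁺ g S y∈S ∷ [])) ⟩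
      rk (image g S)                    ∎
      where open ≤-Reasoning
    ...     | y∈S , y≢x | yes (z , z∈S-x-y) with x∈p-y⁻ (S - x) z∈S-x-y
    ...       | z∈S-x , z≢y with x∈p-y⁻ S z∈S-x
    ...         | z∈S , z≢x = begin
      ∣ S ∣ ⊓ 3                             ≤⟨ m⊓n≤n ∣ S ∣ 3 ⟩
      3                                     ≤⟨ ≰⇒> (g-general x y z (y≢x ∘ sym) (z≢x ∘ sym) (z≢y ∘ sym) ∘ collinear) ⟩
      rk (fromList (g x ∷ g y ∷ g z ∷ []))  ≤⟨ rk-mono (fromList⊆ (g x ∷ g y ∷ g z ∷ [])
                                                 (∈-image⁺ g S x∈S ∷ ∈-image⁺ g S y∈S ∷ ∈-image⁺ g S z∈S ∷ [])) ⟩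
      rk (image g S)                        ∎
      where open ≤-Reasoning

    arc⇒minor : rk ⊤ ≤ 3 → ∀ {m} {g : Fin m → Fin n} → Arc m g → HasUniformMinor M ⊤ 3 m
    arc⇒minor rk⊤≤3 {g = g} arc =
      ⊥ , ∁ (image g ⊤) , ⊥∩-empty , ⊆⊤ , g , proj₁ arc , sym (⊤─[⊥∪∁p]≡p (image g ⊤)) , uniform
      where
      ⊥∩-empty : Disjoint ⊥ (∁ (image g ⊤))
      ⊥∩-empty (x , x∈) = ∉⊥ (proj₁ (x∈p∩q⁻ ⊥ (∁ (image g ⊤)) x∈))
      uniform : ∀ S → rk (image g S ∪ ⊥) ∸ rk ⊥ ≡ uniformRank 3 S
      uniform S = begin
        rk (image g S ∪ ⊥) ∸ rk ⊥   ≡⟨ cong₂ _∸_ (cong rk (∪-identityʳ (image g S))) rk⊥≡0 ⟩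
        rk (image g S)              ≡⟨ ≤-antisym rk≤ (⊓3≤rk-image arc S) ⟩
        ∣ S ∣ ⊓ 3                   ∎
        where
        open ≡-Reasoning
        rk≤ : rk (image g S) ≤ ∣ S ∣ ⊓ 3
        rk≤ = ⊓-glb (≤-trans (rank-≤-card M (image g S)) (∣image∣≤ g S)) (≤-trans (rk-mono ⊆⊤) rk⊤≤3)

    maximal-arc-cover : ∀ {m} {A : Fin m → Fin n} → Arc m A → (∀ g → ¬ Arc (suc m) g) →
                        ⊤ ⊆ image A ⊤ ∪ ⋃ᵖ m (λ i j → line (A i) (A j) - A i - A j)
    maximal-arc-cover {m} {A} arcA A-maximal {e} _ with any? (λ i → e ≟ᶠ A i)
    ... | yes (i , refl) = x∈p∪q⁺ (inj₁ (∈-image⁺ A ⊤ ∈⊤))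
    ... | no e∉A with any? (λ i → any? (λ j → ¬? (i ≟ᶠ j) ×-dec col? (A i) (A j) e))
    ...   | yes (i , j , i≢j , ije) = x∈p∪q⁺ (inj₂ (∈-⋃ᵖ m _ i≢j (on-line ije) (on-line (Col-swap ije))))
      where
      on-line : ∀ {i j} → Col (A i) (A j) e → e ∈ line (A i) (A j) - A i - A j
      on-line {i} {j} ije = x∈p∧x≢y⇒x∈p-y (x∈p∧x≢y⇒x∈p-y (∈-satisfying⁺ (col? (A i) (A j)) ije)
                                                          (e∉A ∘ (i ,_)))
                                          (e∉A ∘ (j ,_))
    ...   | no e-off = ⊥-elim (A-maximal (e ∷ᶠ A)
              (Arc-extend arcA (λ u → e∉A ∘ (u ,_)) (λ u v u≢v uve → e-off (u , v , u≢v , uve))))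

    maximal-arc-bound : ∀ {m} {A : Fin m → Fin n} → Arc m A → (∀ g → ¬ Arc (suc m) g) →
                        ∀ b → (∀ i j → i ≢ j → ∣ line (A i) (A j) ∣ ≤ 2 + b) → n ≤ m + (m C 2) * b
    maximal-arc-bound {m} {A} arcA A-maximal b lines-short = begin
      n                                ≡⟨ sym (∣⊤∣≡n n) ⟩
      ∣ ⊤ {n} ∣                        ≤⟨ p⊆q⇒∣p∣≤∣q∣ (maximal-arc-cover arcA A-maximal) ⟩
      ∣ image A ⊤ ∪ ⋃ᵖ m G ∣           ≤⟨ ∣p∪q∣≤∣p∣+∣q∣ (image A ⊤) (⋃ᵖ m G) ⟩
      ∣ image A ⊤ ∣ + ∣ ⋃ᵖ m G ∣       ≤⟨ +-mono-≤ (≤-trans (∣image∣≤ A ⊤) (≤-reflexive (∣⊤∣≡n m)))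
                                                   (∣⋃ᵖ∣≤ m G b ∣G∣≤b) ⟩
      m + (m C 2) * b                  ∎
      where
      open ≤-Reasoning
      G : Fin m → Fin m → Subset n
      G i j = line (A i) (A j) - A i - A j
      ∣G∣≤b : ∀ i j → i ≢ j → ∣ G i j ∣ ≤ b
      ∣G∣≤b i j i≢j = ≤-pred (≤-pred (begin
        2 + ∣ G i j ∣                  ≡⟨ sym ∣line∣≡2+∣G∣ ⟩
        ∣ line (A i) (A j) ∣           ≤⟨ lines-short i j i≢j ⟩
        2 + b                          ∎))
        where
        Aj∈line-Ai : A j ∈ line (A i) (A j) - A i
        Aj∈line-Ai = x∈p∧x≢y⇒x∈p-y (b∈line (A i) (A j)) (i≢j ∘ sym ∘ proj₁ arcA)
        ∣line∣≡2+∣G∣ : ∣ line (A i) (A j) ∣ ≡ 2 + ∣ G i j ∣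
        ∣line∣≡2+∣G∣ = trans (x∈p⇒∣p∣≡1+∣p-x∣ (line (A i) (A j)) (a∈line (A i) (A j)))
                             (cong suc (x∈p⇒∣p∣≡1+∣p-x∣ (line (A i) (A j) - A i) Aj∈line-Ai))

    module LineOffArc {a b} (a≢b : a ≢ b) {m} {B : Fin m → Fin n} (arcB : Arc m B)
                      (B∉ab : ∀ u → B u ∉ line a b) where

      covered : Subset n
      covered = ⋃ᵖ m (λ u v → line a b ∩ line (B u) (B v))

      ∈-covered : ∀ {u v x} → u ≢ v → x ∈ line a b → Col (B u) (B v) x → x ∈ covered
      ∈-covered {u} {v} u≢v x∈ab uvx = ∈-⋃ᵖ m _ u≢v
        (x∈p∩q⁺ (x∈ab , ∈-satisfying⁺ (col? (B u) (B v)) uvx))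
        (x∈p∩q⁺ (x∈ab , ∈-satisfying⁺ (col? (B v) (B u)) (Col-swap uvx)))

      ∣covered∣≤ : ∣ covered ∣ ≤ m C 2
      ∣covered∣≤ = ≤-trans (∣⋃ᵖ∣≤ m _ 1 λ u v u≢v → ∣line∩line∣≤1 a≢b (u≢v ∘ proj₁ arcB) (B∉ab u))
                           (≤-reflexive (*-identityʳ (m C 2)))

      uncovered-extend : ∀ {y} → y ∈ line a b → y ∉ covered → Arc (suc m) (y ∷ᶠ B)
      uncovered-extend y∈ab y∉cov = Arc-extend arcB
        (λ u y≡Bu → B∉ab u (subst (_∈ line a b) y≡Bu y∈ab))
        (λ u v u≢v uvy → y∉cov (∈-covered u≢v y∈ab uvy))

      uncovered-extend₂ : ∀ {x y} → x ∈ line a b → y ∈ line a b → x ∉ covered → y ∉ covered →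
                          x ≢ y → Arc (suc (suc m)) (x ∷ᶠ y ∷ᶠ B)
      uncovered-extend₂ {x} {y} x∈ab y∈ab x∉cov y∉cov x≢y =
        Arc-extend (uncovered-extend y∈ab y∉cov) x∉yB x-off
        where
        x∉yB : ∀ u → x ≢ (y ∷ᶠ B) u
        x∉yB zero    = x≢y
        x∉yB (suc u) x≡Bu = B∉ab u (subst (_∈ line a b) x≡Bu x∈ab)
        B-off : ∀ u → ¬ Col x y (B u)
        B-off u xyB = B∉ab u (Col⇒∈-line a≢b x≢y x∈ab y∈ab xyB)
        x-off : ∀ u v → u ≢ v → ¬ Col ((y ∷ᶠ B) u) ((y ∷ᶠ B) v) x
        x-off zero    zero    u≢v = ⊥-elim (u≢v refl)
        x-off zero    (suc v) _   = B-off v ∘ Collinear-⊆ (All∈⇒⊆ (∈2 ∷ ∈0 ∷ ∈1 ∷ []))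
        x-off (suc u) zero    _   = B-off u ∘ Collinear-⊆ (All∈⇒⊆ (∈2 ∷ ∈1 ∷ ∈0 ∷ []))
        x-off (suc u) (suc v) u≢v = x∉cov ∘ ∈-covered (u≢v ∘ cong suc) x∈ab

      ∣line∣≤1+mC2 : (∀ g → ¬ Arc (suc (suc m)) g) → ∣ line a b ∣ ≤ suc (m C 2)
      ∣line∣≤1+mC2 no-arc = begin
        ∣ line a b ∣                   ≤⟨ p⊆q⇒∣p∣≤∣q∣ split ⟩
        ∣ uncovered ∪ covered ∣        ≤⟨ ∣p∪q∣≤∣p∣+∣q∣ uncovered covered ⟩
        ∣ uncovered ∣ + ∣ covered ∣    ≤⟨ +-mono-≤ ∣uncovered∣≤1 ∣covered∣≤ ⟩
        suc (m C 2)                    ∎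
        where
        open ≤-Reasoning
        uncovered : Subset n
        uncovered = line a b ─ covered
        split : line a b ⊆ uncovered ∪ covered
        split {x} x∈ab with x ∈? covered
        ... | yes x∈cov = x∈p∪q⁺ (inj₂ x∈cov)
        ... | no  x∉cov = x∈p∪q⁺ (inj₁ (x∈p∧x∉q⇒x∈p─q x∈ab x∉cov))
        ∣uncovered∣≤1 : ∣ uncovered ∣ ≤ 1
        ∣uncovered∣≤1 = subsingleton⇒∣p∣≤1 uncovered λ {x} {y} x∈ y∈ →
          decidable-stable (x ≟ᶠ y) λ x≢y →
            let x∈ab , x∉cov = x∈p─q⁻ (line a b) covered x∈
                y∈ab , y∉cov = x∈p─q⁻ (line a b) covered y∈
            in no-arc _ (uncovered-extend₂ x∈ab y∈ab x∉cov y∉cov x≢y)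

    rich-line : ∀ {m} {A : Fin m → Fin n} → Arc m A → (∀ g → ¬ Arc (suc m) g) →
                ∀ b → m + (m C 2) * b < n → ∃₂ λ i j → i ≢ j × 2 + b < ∣ line (A i) (A j) ∣
    rich-line {A = A} arcA A-maximal b n-large
      with any? (λ i → any? (λ j → ¬? (i ≟ᶠ j) ×-dec (2 + b <? ∣ line (A i) (A j) ∣)))
    ... | yes (i , j , found) = i , j , found
    ... | no none = ⊥-elim (<⇒≱ n-large (maximal-arc-bound arcA A-maximal b
                      λ i j i≢j → ≮⇒≥ λ rich → none (i , j , i≢j , rich)))

    minor-off-line⇒∣line∣≤1+mC2 : ∀ {a b m} → a ≢ b → (∀ g → ¬ Arc (suc (suc m)) g) →
                                  HasUniformMinor M (⊤ ─ line a b) 3 m → ∣ line a b ∣ ≤ suc (m C 2)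
    minor-off-line⇒∣line∣≤1+mC2 {a} {b} a≢b no-arc U₃ₘ with minor⇒arc U₃ₘ
    ... | B , arcB , B∈⊤─ab = LineOffArc.∣line∣≤1+mC2 a≢b arcB (proj₂ ∘ x∈p─q⁻ ⊤ (line a b) ∘ B∈⊤─ab) no-arc

lemma4p4 : (k n : ℕ) → 4 ≤ k → (M : Matroid n) →
    Simple M → rank M ⊤ ≡ 3 →
    HasUniformMinor M ⊤ 3 k → ¬ HasUniformMinor M ⊤ 3 (k + 1) →
    ((k ∸ 1) C 2 ∸ 1) * (k C 2) + k < n →
    Σ (Subset n) λ ℓ → Line M ℓ × ¬ HasUniformMinor M (⊤ ─ ℓ) 3 (k ∸ 1)
-- The hypothesis 4 ≤ k only serves to exclude k = 0.
lemma4p4 zero    _ ()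
lemma4p4 (suc k) n _ M simple rank≡3 U₃,₁₊ₖ ¬U₃,₂₊ₖ n-large = rich-line-works
  where
  open Geometry M
  no-[2+k]-arc : ∀ g → ¬ Arc (suc (suc k)) g
  no-[2+k]-arc g arc =
    ¬U₃,₂₊ₖ (subst (HasUniformMinor M ⊤ 3) (+-comm 1 (suc k)) (arc⇒minor simple (≤-reflexive rank≡3) arc))
  n-large′ : suc k + (suc k C 2) * (k C 2 ∸ 1) < n
  n-large′ = subst (_< n) (trans (+-comm _ (suc k)) (cong (suc k +_) (*-comm (k C 2 ∸ 1) _))) n-large
  rich-line-works : Σ (Subset n) λ ℓ → Line M ℓ × ¬ HasUniformMinor M (⊤ ─ ℓ) 3 k
  rich-line-works with minor⇒arc U₃,₁₊ₖ
  ... | A , arcA , _ with rich-line simple arcA no-[2+k]-arc (k C 2 ∸ 1) n-large′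
  ...   | i , j , i≢j , rich = line (A i) (A j) , line-Line simple Ai≢Aj , λ U₃,ₖ →
          <⇒≱ rich (≤-trans (minor-off-line⇒∣line∣≤1+mC2 simple Ai≢Aj no-[2+k]-arc U₃,ₖ) (s≤s (m≤n+m∸n (k C 2) 1)))
    where
    Ai≢Aj : A i ≢ A j
    Ai≢Aj = i≢j ∘ proj₁ arcA
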